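{- For all integers $m,n\ge 1$, \[ T_{2m,n}(q)=\sum_{r=0}^{m-1}(-1)^r\binom{2m}{r}\frac{(1-q^{n(m-r)})(1-q^{(n+1)(m-r)})q^{rn}}{(1-q)^{2m}(1+q^{m-r})}. \]
   Context: $q$ is an indeterminate and identities are identities of rational functions in $q^{1/2}$. For positive integers $m,n$, \[ T_{m,n}(q)=\sum_{k=1}^{n}(-1)^{n-k}\left(\frac{1-q^k}{1-q}\right)^{m}q^{\frac{m}{2}(n-k)}. \] -}

module Defs where

open import Data.Nat as ℕ using (ℕ; zero; suc)
open import Data.Rational using (ℚ; 0ℚ; 1ℚ; _+_; _*_; _-_; -_; 1/_; ≢-nonZero; _≟_)
open import Relation.Nullary using (yes; no)
open import Data.Integer using (+_)
open import Data.Rational using (_/_)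

ℕ→ℚ : ℕ → ℚ
ℕ→ℚ k = (+ k) / 1

pow : ℚ → ℕ → ℚ
pow x zero    = 1ℚ
pow x (suc k) = x * pow x k

-- total inverse on ℚ (inv 0 = 0); only ever applied to nonzero denominators
inv : ℚ → ℚ
inv p with p ≟ 0ℚ
... | yes _ = 0ℚ
... | no p≢0 = 1/_ p {{≢-nonZero p≢0}}

ΣFrom : ℕ → ℕ → (ℕ → ℚ) → ℚ
ΣFrom a zero    f = 0ℚ
ΣFrom a (suc b) f = f a + ΣFrom (suc a) b f

-- sum_{k=lo}^{hi} f k  (empty if hi < lo)
Σ[_to_] : ℕ → ℕ → (ℕ → ℚ) → ℚ
Σ[ lo to hi ] f = ΣFrom lo (suc hi ℕ.∸ lo) f

sgn : ℕ → ℚ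
sgn k = pow (- 1ℚ) k

-- T_{m,n} evaluated at q^{1/2} = s, i.e. q = s*s:
-- T_{m,n}(q) = sum_{k=1}^{n} (-1)^{n-k} ((1-q^k)/(1-q))^m q^{(m/2)(n-k)},
-- where q^{(m/2)(n-k)} = s^{m(n-k)}.
T : ℕ → ℕ → ℚ → ℚ
T m n s = Σ[ 1 to n ] λ k →
  sgn (n ℕ.∸ k) * pow ((1ℚ - pow q k) * inv (1ℚ - q)) m * pow s (m ℕ.* (n ℕ.∸ k))
  where q = s * s

{-# OPTIONS --safe #-}
-- Write q = s², c = q^m and [k] = (1 - qᵏ)/(1 - q). Splitting off the last summand of T gives
-- T_{2m,n+1} = - c T_{2m,n} + [n+1]^{2m} and T_{2m,0} = 0, so it suffices to check that the
-- right-hand side R_n obeys the same recurrence. In R_{n+1} + c R_n the r-th summands combine,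
-- through (1 - P²U) + P(1 - U) = (1 + P)(1 - PU) with P = q^{m-r} and U = q^{n(m-r)}, into
-- (-1)^r C(2m,r) y^r (1 - y^{m-r})² / (1 - q)^{2m} with y = q^{n+1}; the factor 1 + q^{m-r} cancels
-- because it is positive. Finally Σ_{r<m} (-1)^r C(2m,r) y^r (1 - y^{m-r})² = (1 - y)^{2m}: expand
-- y^r (1 - y^{m-r})² = y^r + y^{2m-r} - 2 y^m and fold the binomial expansion of (1 - y)^{2m} about
-- its middle term; the y^m terms add up to y^m (1 - 1)^{2m} = 0.
module Submission where

open import Defs
open import Data.Nat as ℕ using (ℕ; _≤_)
open import Data.Nat.Combinatorics using (_C_)
open import Data.Rational using (ℚ; 1ℚ; _+_; _*_; _-_)
open import Relation.Binary.PropositionalEquality using (_≡_; _≢_)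

open import Algebra.Bundles using (CommutativeRing)
open import Data.Fin.Base using (toℕ)
import Data.Integer.Base as ℤ
import Data.Integer.Tactic.RingSolver as ℤ-Solver
open import Data.Nat using (zero; suc; _<_; NonZero; s≤s; z≤n)
import Data.Nat.Combinatorics as ℕ
import Data.Nat.Properties as ℕ
import Data.Nat.Tactic.RingSolver as ℕ-Solver
open import Data.Rational
  using (0ℚ; -_; _≟_; toℚᵘ; NonNegative; nonNegative; nonPositive; ≢-nonZero)
import Data.Rational.Properties as ℚ
open import Data.Rational.Unnormalised as ℚᵘ using (mkℚᵘ; *≡*)
import Data.Rational.Unnormalised.Properties as ℚᵘ
open import Data.Sum using (inj₁; inj₂)
open import Level using (0ℓ)
open import Relation.Binary.PropositionalEquality
  using (refl; sym; trans; cong; cong₂; subst; module ≡-Reasoning)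
open import Relation.Nullary using (yes; no; contradiction)
open import Relation.Nullary.Decidable.Core using (dec⇒maybe)
open import Tactic.RingSolver using (solve-∀)
open import Tactic.RingSolver.Core.AlmostCommutativeRing
  using (AlmostCommutativeRing; fromCommutativeRing)

open CommutativeRing ℚ.+-*-commutativeRing using (commutativeSemiring; semiring)
import Algebra.Properties.CommutativeSemiring.Binomial commutativeSemiring as Binomial
open import Algebra.Properties.CommutativeSemiring.Exp commutativeSemiring using (_^_)
open import Algebra.Properties.Semiring.Mult semiring using (_×_)
open import Algebra.Properties.Semiring.Sum semiring using (sum-syntax; sum-cong-≗)

ℚ-ring : AlmostCommutativeRing 0ℓ 0ℓ
ℚ-ring = fromCommutativeRing ℚ.+-*-commutativeRing (λ x → dec⇒maybe (0ℚ ≟ x))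

ℕ→ℚ-suc : ∀ n → ℕ→ℚ (suc n) ≡ 1ℚ + ℕ→ℚ n
ℕ→ℚ-suc n = ℚ.toℚᵘ-injective (begin-equality
  toℚᵘ (ℕ→ℚ (suc n))           ≃⟨ ℚ.toℚᵘ-fromℚᵘ (mkℚᵘ (ℤ.+ suc n) 0) ⟩
  mkℚᵘ (ℤ.+ suc n) 0           ≃⟨ *≡* (cross-multiplied (ℤ.+ n)) ⟩
  ℚᵘ.1ℚᵘ ℚᵘ.+ mkℚᵘ (ℤ.+ n) 0   ≃⟨ ℚᵘ.+-congʳ _ (ℚ.toℚᵘ-fromℚᵘ (mkℚᵘ (ℤ.+ n) 0)) ⟨
  toℚᵘ 1ℚ ℚᵘ.+ toℚᵘ (ℕ→ℚ n)    ≃⟨ ℚ.toℚᵘ-homo-+ 1ℚ (ℕ→ℚ n) ⟨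
  toℚᵘ (1ℚ + ℕ→ℚ n)            ∎)
  where
  open ℚᵘ.≤-Reasoning
  cross-multiplied : ∀ x → (ℤ.1ℤ ℤ.+ x) ℤ.* (ℤ.1ℤ ℤ.* ℤ.1ℤ)
                           ≡ (ℤ.1ℤ ℤ.* ℤ.1ℤ ℤ.+ x ℤ.* ℤ.1ℤ) ℤ.* ℤ.1ℤ
  cross-multiplied = ℤ-Solver.solve-∀

open ≡-Reasoning

×≡ℕ→ℚ* : ∀ n x → n × x ≡ ℕ→ℚ n * x
×≡ℕ→ℚ* zero    x = sym (ℚ.*-zeroˡ x)
×≡ℕ→ℚ* (suc n) x = begin
  x + n × x           ≡⟨ cong (x +_) (×≡ℕ→ℚ* n x) ⟩
  x + ℕ→ℚ n * x       ≡⟨ cong (_+ ℕ→ℚ n * x) (ℚ.*-identityˡ x) ⟨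
  1ℚ * x + ℕ→ℚ n * x  ≡⟨ ℚ.*-distribʳ-+ x 1ℚ (ℕ→ℚ n) ⟨
  (1ℚ + ℕ→ℚ n) * x    ≡⟨ cong (_* x) (ℕ→ℚ-suc n) ⟨
  ℕ→ℚ (suc n) * x     ∎

ΣFrom-cong : ∀ a b {f g : ℕ → ℚ} → (∀ i → i < b → f (a ℕ.+ i) ≡ g (a ℕ.+ i)) →
             ΣFrom a b f ≡ ΣFrom a b g
ΣFrom-cong a zero    f≡g = refl
ΣFrom-cong a (suc b) {f} {g} f≡g = cong₂ _+_ first (ΣFrom-cong (suc a) b rest)
  where
  first : f a ≡ g a
  first = subst (λ k → f k ≡ g k) (ℕ.+-identityʳ a) (f≡g 0 (s≤s z≤n))
  rest : ∀ i → i < b → f (suc a ℕ.+ i) ≡ g (suc a ℕ.+ i)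
  rest i i<b = subst (λ k → f k ≡ g k) (ℕ.+-suc a i) (f≡g (suc i) (s≤s i<b))

ΣFrom-suc : ∀ a b (f : ℕ → ℚ) → ΣFrom (suc a) b f ≡ ΣFrom a b (λ i → f (suc i))
ΣFrom-suc a zero    f = refl
ΣFrom-suc a (suc b) f = cong (f (suc a) +_) (ΣFrom-suc (suc a) b f)

ΣFrom-shift : ∀ a b (f : ℕ → ℚ) → ΣFrom a b f ≡ ΣFrom 0 b (λ i → f (a ℕ.+ i))
ΣFrom-shift zero    b f = refl
ΣFrom-shift (suc a) b f = trans (ΣFrom-suc a b f) (ΣFrom-shift a b (λ i → f (suc i)))

ΣFrom-snoc : ∀ a b (f : ℕ → ℚ) → ΣFrom a (suc b) f ≡ ΣFrom a b f + f (a ℕ.+ b)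
ΣFrom-snoc a zero    f = begin
  f a + 0ℚ          ≡⟨ ℚ.+-identityʳ (f a) ⟩
  f a               ≡⟨ cong f (ℕ.+-identityʳ a) ⟨
  f (a ℕ.+ 0)       ≡⟨ ℚ.+-identityˡ (f (a ℕ.+ 0)) ⟨
  0ℚ + f (a ℕ.+ 0)  ∎
ΣFrom-snoc a (suc b) f = begin
  f a + ΣFrom (suc a) (suc b) f                ≡⟨ cong (f a +_) (ΣFrom-snoc (suc a) b f) ⟩
  f a + (ΣFrom (suc a) b f + f (suc a ℕ.+ b))  ≡⟨ ℚ.+-assoc (f a) _ _ ⟨
  f a + ΣFrom (suc a) b f + f (suc a ℕ.+ b)    ≡⟨ cong (λ k → f a + ΣFrom (suc a) b f + f k) (ℕ.+-suc a b) ⟨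
  f a + ΣFrom (suc a) b f + f (a ℕ.+ suc b)    ∎

ΣFrom-split : ∀ a b c (f : ℕ → ℚ) → ΣFrom a (b ℕ.+ c) f ≡ ΣFrom a b f + ΣFrom (a ℕ.+ b) c f
ΣFrom-split a zero    c f = begin
  ΣFrom a c f               ≡⟨ cong (λ k → ΣFrom k c f) (ℕ.+-identityʳ a) ⟨
  ΣFrom (a ℕ.+ 0) c f       ≡⟨ ℚ.+-identityˡ _ ⟨
  0ℚ + ΣFrom (a ℕ.+ 0) c f  ∎
ΣFrom-split a (suc b) c f = begin
  f a + ΣFrom (suc a) (b ℕ.+ c) f                      ≡⟨ cong (f a +_) (ΣFrom-split (suc a) b c f) ⟩
  f a + (ΣFrom (suc a) b f + ΣFrom (suc a ℕ.+ b) c f)  ≡⟨ ℚ.+-assoc (f a) _ _ ⟨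
  f a + ΣFrom (suc a) b f + ΣFrom (suc a ℕ.+ b) c f    ≡⟨ cong (λ k → f a + ΣFrom (suc a) b f + ΣFrom k c f)
                                                               (ℕ.+-suc a b) ⟨
  f a + ΣFrom (suc a) b f + ΣFrom (a ℕ.+ suc b) c f    ∎

ΣFrom-zero : ∀ a b → ΣFrom a b (λ _ → 0ℚ) ≡ 0ℚ
ΣFrom-zero a zero    = refl
ΣFrom-zero a (suc b) = trans (cong (0ℚ +_) (ΣFrom-zero (suc a) b)) (ℚ.+-identityˡ 0ℚ)

ΣFrom-distrib-+ : ∀ a b (f g : ℕ → ℚ) →
                  ΣFrom a b (λ i → f i + g i) ≡ ΣFrom a b f + ΣFrom a b g
ΣFrom-distrib-+ a zero    f g = sym (ℚ.+-identityˡ 0ℚ)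
ΣFrom-distrib-+ a (suc b) f g = begin
  f a + g a + ΣFrom (suc a) b (λ i → f i + g i)          ≡⟨ cong (f a + g a +_) (ΣFrom-distrib-+ (suc a) b f g) ⟩
  f a + g a + (ΣFrom (suc a) b f + ΣFrom (suc a) b g)    ≡⟨ interchange (f a) (g a) _ _ ⟩
  f a + ΣFrom (suc a) b f + (g a + ΣFrom (suc a) b g)    ∎
  where
  interchange : ∀ w x y z → w + x + (y + z) ≡ w + y + (x + z)
  interchange = solve-∀ ℚ-ring

*-distribˡ-ΣFrom : ∀ a b c (f : ℕ → ℚ) → c * ΣFrom a b f ≡ ΣFrom a b (λ i → c * f i)
*-distribˡ-ΣFrom a zero    c f = ℚ.*-zeroʳ c
*-distribˡ-ΣFrom a (suc b) c f =
  trans (ℚ.*-distribˡ-+ c (f a) _) (cong (c * f a +_) (*-distribˡ-ΣFrom (suc a) b c f))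

ΣFrom-reverse : ∀ b (f : ℕ → ℚ) → ΣFrom 0 b (λ i → f (b ℕ.∸ suc i)) ≡ ΣFrom 0 b f
ΣFrom-reverse zero    f = refl
ΣFrom-reverse (suc b) f = begin
  ΣFrom 0 (suc b) (λ i → f (b ℕ.∸ i))
    ≡⟨ ΣFrom-snoc 0 b _ ⟩
  ΣFrom 0 b (λ i → f (b ℕ.∸ i)) + f (b ℕ.∸ b)
    ≡⟨ cong₂ _+_ (ΣFrom-cong 0 b (λ _ i<b → cong f (b∸i≡1+b∸[1+i] i<b))) (cong f (ℕ.n∸n≡0 b)) ⟩
  ΣFrom 0 b (λ i → f (suc (b ℕ.∸ suc i))) + f 0
    ≡⟨ ℚ.+-comm _ (f 0) ⟩
  f 0 + ΣFrom 0 b (λ i → f (suc (b ℕ.∸ suc i)))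
    ≡⟨ cong (f 0 +_) (ΣFrom-reverse b (λ i → f (suc i))) ⟩
  f 0 + ΣFrom 0 b (λ i → f (suc i))
    ≡⟨ cong (f 0 +_) (ΣFrom-suc 0 b f) ⟨
  ΣFrom 0 (suc b) f ∎
  where
  b∸i≡1+b∸[1+i] : ∀ {i} → i < b → b ℕ.∸ i ≡ suc (b ℕ.∸ suc i)
  b∸i≡1+b∸[1+i] = ℕ.+-∸-assoc 1

ΣFrom-fold : ∀ m (f : ℕ → ℚ) →
             ΣFrom 0 (suc (2 ℕ.* m)) f ≡ ΣFrom 0 m (λ r → f r + f (2 ℕ.* m ℕ.∸ r)) + f m
ΣFrom-fold m f = begin
  ΣFrom 0 (suc (2 ℕ.* m)) f                                  ≡⟨ cong (λ k → ΣFrom 0 k f) 2m+1≡m+[m+1] ⟩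
  ΣFrom 0 (m ℕ.+ suc m) f                                    ≡⟨ ΣFrom-split 0 m (suc m) f ⟩
  ΣFrom 0 m f + (f m + ΣFrom (suc m) m f)                    ≡⟨ cong (λ t → ΣFrom 0 m f + (f m + t)) upper-half ⟩
  ΣFrom 0 m f + (f m + ΣFrom 0 m (λ r → f (2 ℕ.* m ℕ.∸ r)))  ≡⟨ rearrange (ΣFrom 0 m f) (f m) _ ⟩
  ΣFrom 0 m f + ΣFrom 0 m (λ r → f (2 ℕ.* m ℕ.∸ r)) + f m    ≡⟨ cong (_+ f m) (ΣFrom-distrib-+ 0 m f _) ⟨
  ΣFrom 0 m (λ r → f r + f (2 ℕ.* m ℕ.∸ r)) + f m            ∎
  where
  2m+1≡m+[m+1] : suc (2 ℕ.* m) ≡ m ℕ.+ suc m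
  2m+1≡m+[m+1] = trans (cong (λ k → suc (m ℕ.+ k)) (ℕ.+-identityʳ m)) (sym (ℕ.+-suc m m))
  reflect : ∀ {i} → i < m → suc m ℕ.+ (m ℕ.∸ suc i) ≡ 2 ℕ.* m ℕ.∸ i
  reflect {i} i<m = begin
    suc m ℕ.+ (m ℕ.∸ suc i)  ≡⟨ ℕ.+-suc m _ ⟨
    m ℕ.+ suc (m ℕ.∸ suc i)  ≡⟨ cong (m ℕ.+_) (ℕ.+-∸-assoc 1 i<m) ⟨
    m ℕ.+ (m ℕ.∸ i)          ≡⟨ ℕ.+-∸-assoc m (ℕ.<⇒≤ i<m) ⟨
    m ℕ.+ m ℕ.∸ i            ≡⟨ cong (λ k → m ℕ.+ k ℕ.∸ i) (ℕ.+-identityʳ m) ⟨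
    2 ℕ.* m ℕ.∸ i            ∎
  upper-half : ΣFrom (suc m) m f ≡ ΣFrom 0 m (λ r → f (2 ℕ.* m ℕ.∸ r))
  upper-half = begin
    ΣFrom (suc m) m f                              ≡⟨ ΣFrom-shift (suc m) m f ⟩
    ΣFrom 0 m (λ i → f (suc m ℕ.+ i))              ≡⟨ ΣFrom-reverse m _ ⟨
    ΣFrom 0 m (λ i → f (suc m ℕ.+ (m ℕ.∸ suc i)))  ≡⟨ ΣFrom-cong 0 m (λ i i<m → cong f (reflect i<m)) ⟩
    ΣFrom 0 m (λ r → f (2 ℕ.* m ℕ.∸ r))            ∎
  rearrange : ∀ x y z → x + (y + z) ≡ x + z + y
  rearrange = solve-∀ ℚ-ring

ΣFrom≡∑ : ∀ n (f : ℕ → ℚ) → ΣFrom 0 n f ≡ ∑[ i < n ] f (toℕ i)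
ΣFrom≡∑ zero    f = refl
ΣFrom≡∑ (suc n) f = cong (f 0 +_) (trans (ΣFrom-suc 0 n f) (ΣFrom≡∑ n (λ i → f (suc i))))

pow≡^ : ∀ x k → pow x k ≡ x ^ k
pow≡^ x zero    = refl
pow≡^ x (suc k) = cong (x *_) (pow≡^ x k)

pow-+ : ∀ x a b → pow x (a ℕ.+ b) ≡ pow x a * pow x b
pow-+ x zero    b = sym (ℚ.*-identityˡ (pow x b))
pow-+ x (suc a) b = trans (cong (x *_) (pow-+ x a b)) (sym (ℚ.*-assoc x (pow x a) (pow x b)))

pow-2* : ∀ x k → pow x (2 ℕ.* k) ≡ pow x k * pow x k
pow-2* x k = trans (pow-+ x k (k ℕ.+ 0)) (cong (λ j → pow x k * pow x j) (ℕ.+-identityʳ k))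

pow-distrib-* : ∀ x y k → pow (x * y) k ≡ pow x k * pow y k
pow-distrib-* x y zero    = sym (ℚ.*-identityˡ 1ℚ)
pow-distrib-* x y (suc k) = trans (cong (x * y *_) (pow-distrib-* x y k)) (interchange x y _ _)
  where
  interchange : ∀ w x y z → w * x * (y * z) ≡ w * y * (x * z)
  interchange = solve-∀ ℚ-ring

pow-*-assoc : ∀ x a b → pow (pow x a) b ≡ pow x (a ℕ.* b)
pow-*-assoc x a zero    = cong (pow x) (sym (ℕ.*-zeroʳ a))
pow-*-assoc x a (suc b) = begin
  pow x a * pow (pow x a) b  ≡⟨ cong (pow x a *_) (pow-*-assoc x a b) ⟩
  pow x a * pow x (a ℕ.* b)  ≡⟨ pow-+ x a (a ℕ.* b) ⟨
  pow x (a ℕ.+ a ℕ.* b)      ≡⟨ cong (pow x) (ℕ.*-suc a b) ⟨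
  pow x (a ℕ.* suc b)        ∎

pow-2*≡pow-square : ∀ x k → pow x (2 ℕ.* k) ≡ pow (x * x) k
pow-2*≡pow-square x k = trans (pow-2* x k) (sym (pow-distrib-* x x k))

pow-1ℚ : ∀ k → pow 1ℚ k ≡ 1ℚ
pow-1ℚ zero    = refl
pow-1ℚ (suc k) = trans (cong (1ℚ *_) (pow-1ℚ k)) (ℚ.*-identityˡ 1ℚ)

pow-0ℚ : ∀ k → .{{NonZero k}} → pow 0ℚ k ≡ 0ℚ
pow-0ℚ (suc k) = ℚ.*-zeroˡ (pow 0ℚ k)

pow-neg : ∀ x k → pow (- x) k ≡ sgn k * pow x k
pow-neg x k = begin
  pow (- x) k         ≡⟨ cong (λ y → pow (- y) k) (ℚ.*-identityˡ x) ⟨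
  pow (- (1ℚ * x)) k  ≡⟨ cong (λ y → pow y k) (ℚ.neg-distribˡ-* 1ℚ x) ⟩
  pow (- 1ℚ * x) k    ≡⟨ pow-distrib-* (- 1ℚ) x k ⟩
  sgn k * pow x k     ∎

sgn-2* : ∀ k → sgn (2 ℕ.* k) ≡ 1ℚ
sgn-2* k = trans (sym (pow-*-assoc (- 1ℚ) 2 k)) (pow-1ℚ k)

2*m∸i≡2*[m∸i]+i : ∀ {m i} → i ≤ m → 2 ℕ.* m ℕ.∸ i ≡ 2 ℕ.* (m ℕ.∸ i) ℕ.+ i
2*m∸i≡2*[m∸i]+i {m} {i} i≤m = begin
  2 ℕ.* m ℕ.∸ i                        ≡⟨ cong (λ k → 2 ℕ.* k ℕ.∸ i) (ℕ.m+[n∸m]≡n i≤m) ⟨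
  2 ℕ.* (i ℕ.+ (m ℕ.∸ i)) ℕ.∸ i        ≡⟨ cong (ℕ._∸ i) (regroup i (m ℕ.∸ i)) ⟩
  i ℕ.+ (2 ℕ.* (m ℕ.∸ i) ℕ.+ i) ℕ.∸ i  ≡⟨ ℕ.m+n∸m≡n i _ ⟩
  2 ℕ.* (m ℕ.∸ i) ℕ.+ i                ∎
  where
  regroup : ∀ i k → 2 ℕ.* (i ℕ.+ k) ≡ i ℕ.+ (2 ℕ.* k ℕ.+ i)
  regroup = ℕ-Solver.solve-∀

sgn-reflect : ∀ {m i} → i ≤ m → sgn (2 ℕ.* m ℕ.∸ i) ≡ sgn i
sgn-reflect {m} {i} i≤m = begin
  sgn (2 ℕ.* m ℕ.∸ i)            ≡⟨ cong sgn (2*m∸i≡2*[m∸i]+i i≤m) ⟩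
  sgn (2 ℕ.* (m ℕ.∸ i) ℕ.+ i)    ≡⟨ pow-+ (- 1ℚ) (2 ℕ.* (m ℕ.∸ i)) i ⟩
  sgn (2 ℕ.* (m ℕ.∸ i)) * sgn i  ≡⟨ cong (_* sgn i) (sgn-2* (m ℕ.∸ i)) ⟩
  1ℚ * sgn i                     ≡⟨ ℚ.*-identityˡ (sgn i) ⟩
  sgn i                          ∎

alternatingBinomial : ℕ → ℕ → ℚ
alternatingBinomial M j = sgn j * ℕ→ℚ (M C j)

alternatingBinomial-reflect : ∀ {m i} → i ≤ m →
  alternatingBinomial (2 ℕ.* m) (2 ℕ.* m ℕ.∸ i) ≡ alternatingBinomial (2 ℕ.* m) i
alternatingBinomial-reflect {m} {i} i≤m =
  cong₂ _*_ (sgn-reflect i≤m) (cong ℕ→ℚ (sym (ℕ.nCk≡nC[n∸k] (ℕ.≤-trans i≤m (ℕ.m≤n*m m 2)))))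

binomial-theorem : ∀ M y → ΣFrom 0 (suc M) (λ j → alternatingBinomial M j * pow y j) ≡ pow (1ℚ - y) M
binomial-theorem M y = begin
  ΣFrom 0 (suc M) term                    ≡⟨ ΣFrom≡∑ (suc M) term ⟩
  ∑[ k < suc M ] term (toℕ k)             ≡⟨ sum-cong-≗ {suc M} (λ k → libraryTerm≡term (toℕ k)) ⟨
  Binomial.binomialExpansion (- y) 1ℚ M   ≡⟨ Binomial.theorem M (- y) 1ℚ ⟨
  (- y + 1ℚ) ^ M                          ≡⟨ cong (_^ M) (ℚ.+-comm (- y) 1ℚ) ⟩
  (1ℚ - y) ^ M                            ≡⟨ pow≡^ (1ℚ - y) M ⟨
  pow (1ℚ - y) M                          ∎
  where
  term : ℕ → ℚ
  term j = alternatingBinomial M j * pow y j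
  libraryTerm≡term : ∀ j → (M C j) × ((- y) ^ j * 1ℚ ^ (M ℕ.∸ j)) ≡ term j
  libraryTerm≡term j = begin
    (M C j) × ((- y) ^ j * 1ℚ ^ (M ℕ.∸ j))          ≡⟨ ×≡ℕ→ℚ* (M C j) _ ⟩
    ℕ→ℚ (M C j) * ((- y) ^ j * 1ℚ ^ (M ℕ.∸ j))      ≡⟨ cong₂ (λ u v → ℕ→ℚ (M C j) * (u * v))
                                                             (pow≡^ (- y) j) (pow≡^ 1ℚ (M ℕ.∸ j)) ⟨
    ℕ→ℚ (M C j) * (pow (- y) j * pow 1ℚ (M ℕ.∸ j))  ≡⟨ cong₂ (λ u v → ℕ→ℚ (M C j) * (u * v))
                                                             (pow-neg y j) (pow-1ℚ (M ℕ.∸ j)) ⟩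
    ℕ→ℚ (M C j) * (sgn j * pow y j * 1ℚ)            ≡⟨ regroup (ℕ→ℚ (M C j)) (sgn j) (pow y j) ⟩
    sgn j * ℕ→ℚ (M C j) * pow y j                   ∎
    where
    regroup : ∀ c σ z → c * (σ * z * 1ℚ) ≡ σ * c * z
    regroup = solve-∀ ℚ-ring

folded-binomial : ∀ m y →
  ΣFrom 0 m (λ r → alternatingBinomial (2 ℕ.* m) r * (pow y r + pow y (2 ℕ.* m ℕ.∸ r)))
    + alternatingBinomial (2 ℕ.* m) m * pow y m
  ≡ pow (1ℚ - y) (2 ℕ.* m)
folded-binomial m y = begin
  ΣFrom 0 m (λ r → φ r * (pow y r + pow y (2 ℕ.* m ℕ.∸ r))) + term m
    ≡⟨ cong (_+ term m) (ΣFrom-cong 0 m (λ r r<m → pair r<m)) ⟩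
  ΣFrom 0 m (λ r → term r + term (2 ℕ.* m ℕ.∸ r)) + term m
    ≡⟨ ΣFrom-fold m term ⟨
  ΣFrom 0 (suc (2 ℕ.* m)) term
    ≡⟨ binomial-theorem (2 ℕ.* m) y ⟩
  pow (1ℚ - y) (2 ℕ.* m) ∎
  where
  φ term : ℕ → ℚ
  φ = alternatingBinomial (2 ℕ.* m)
  term j = φ j * pow y j
  pair : ∀ {r} → r < m → φ r * (pow y r + pow y (2 ℕ.* m ℕ.∸ r)) ≡ term r + term (2 ℕ.* m ℕ.∸ r)
  pair {r} r<m = trans (ℚ.*-distribˡ-+ (φ r) _ _)
    (cong (λ c → term r + c * pow y (2 ℕ.* m ℕ.∸ r)) (sym (alternatingBinomial-reflect (ℕ.<⇒≤ r<m))))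

alternating-binomial-squares : ∀ m .{{_ : NonZero m}} y →
  ΣFrom 0 m (λ r → alternatingBinomial (2 ℕ.* m) r
                   * (pow y r * (1ℚ - pow y (m ℕ.∸ r)) * (1ℚ - pow y (m ℕ.∸ r))))
  ≡ pow (1ℚ - y) (2 ℕ.* m)
alternating-binomial-squares m y = begin
  ΣFrom 0 m (λ r → φ r * (Y r * (1ℚ - Y (m ℕ.∸ r)) * (1ℚ - Y (m ℕ.∸ r))))
    ≡⟨ ΣFrom-cong 0 m (λ r r<m → expand r<m) ⟩
  ΣFrom 0 m (λ r → φ r * (Y r + Y (2 ℕ.* m ℕ.∸ r)) + (- Y m) * (φ r * 2ℚ))
    ≡⟨ ΣFrom-distrib-+ 0 m _ _ ⟩
  A + ΣFrom 0 m (λ r → (- Y m) * (φ r * 2ℚ))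
    ≡⟨ cong (A +_) (*-distribˡ-ΣFrom 0 m (- Y m) (λ r → φ r * 2ℚ)) ⟨
  A + (- Y m) * B
    ≡⟨ regroup A B (φ m) (Y m) ⟩
  A + φ m * Y m + (- Y m) * (B + φ m * 1ℚ)
    ≡⟨ cong₂ (λ u v → u + (- Y m) * v) (folded-binomial m y) folded-binomial-at-1 ⟩
  pow (1ℚ - y) (2 ℕ.* m) + (- Y m) * 0ℚ
    ≡⟨ drop-zero (pow (1ℚ - y) (2 ℕ.* m)) (Y m) ⟩
  pow (1ℚ - y) (2 ℕ.* m) ∎
  where
  φ Y : ℕ → ℚ
  φ = alternatingBinomial (2 ℕ.* m)
  Y = pow y
  2ℚ A B : ℚ
  2ℚ = 1ℚ + 1ℚ
  A = ΣFrom 0 m (λ r → φ r * (Y r + Y (2 ℕ.* m ℕ.∸ r)))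
  B = ΣFrom 0 m (λ r → φ r * 2ℚ)
  B≡Σ1ʳ+1²ᵐ⁻ʳ : B ≡ ΣFrom 0 m (λ r → φ r * (pow 1ℚ r + pow 1ℚ (2 ℕ.* m ℕ.∸ r)))
  B≡Σ1ʳ+1²ᵐ⁻ʳ = ΣFrom-cong 0 m (λ r _ → cong (φ r *_) (sym (cong₂ _+_ (pow-1ℚ r) (pow-1ℚ (2 ℕ.* m ℕ.∸ r)))))
  folded-binomial-at-1 : B + φ m * 1ℚ ≡ 0ℚ
  folded-binomial-at-1 = begin
    B + φ m * 1ℚ
      ≡⟨ cong₂ (λ u v → u + φ m * v) B≡Σ1ʳ+1²ᵐ⁻ʳ (sym (pow-1ℚ m)) ⟩
    ΣFrom 0 m (λ r → φ r * (pow 1ℚ r + pow 1ℚ (2 ℕ.* m ℕ.∸ r))) + φ m * pow 1ℚ m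
      ≡⟨ folded-binomial m 1ℚ ⟩
    pow 0ℚ (2 ℕ.* m)
      ≡⟨ pow-0ℚ (2 ℕ.* m) {{ℕ.m*n≢0 2 m}} ⟩
    0ℚ ∎
  expand : ∀ {r} → r < m → φ r * (Y r * (1ℚ - Y (m ℕ.∸ r)) * (1ℚ - Y (m ℕ.∸ r)))
                         ≡ φ r * (Y r + Y (2 ℕ.* m ℕ.∸ r)) + (- Y m) * (φ r * 2ℚ)
  expand {r} r<m = begin
    φ r * (Y r * (1ℚ - Y a) * (1ℚ - Y a))
      ≡⟨ square-expansion (φ r) (Y r) (Y a) ⟩
    φ r * (Y r + Y a * Y a * Y r) + (- (Y a * Y r)) * (φ r * 2ℚ)
      ≡⟨ cong₂ (λ u v → φ r * (Y r + u) + (- v) * (φ r * 2ℚ)) y²ᵐ⁻ʳ yᵐ ⟨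
    φ r * (Y r + Y (2 ℕ.* m ℕ.∸ r)) + (- Y m) * (φ r * 2ℚ) ∎
    where
    a : ℕ
    a = m ℕ.∸ r
    r≤m : r ≤ m
    r≤m = ℕ.<⇒≤ r<m
    y²ᵐ⁻ʳ : Y (2 ℕ.* m ℕ.∸ r) ≡ Y a * Y a * Y r
    y²ᵐ⁻ʳ = trans (cong Y (2*m∸i≡2*[m∸i]+i r≤m))
                   (trans (pow-+ y (2 ℕ.* a) r) (cong (_* Y r) (pow-2* y a)))
    yᵐ : Y m ≡ Y a * Y r
    yᵐ = trans (cong Y (sym (ℕ.m∸n+n≡m r≤m))) (pow-+ y a r)
    square-expansion : ∀ c u v → c * (u * (1ℚ - v) * (1ℚ - v))
                                 ≡ c * (u + v * v * u) + (- (v * u)) * (c * (1ℚ + 1ℚ))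
    square-expansion = solve-∀ ℚ-ring
  regroup : ∀ a b c y → a + (- y) * b ≡ a + c * y + (- y) * (b + c * 1ℚ)
  regroup = solve-∀ ℚ-ring
  drop-zero : ∀ a y → a + (- y) * 0ℚ ≡ a
  drop-zero = solve-∀ ℚ-ring

inv-inverseˡ : ∀ {x} → x ≢ 0ℚ → inv x * x ≡ 1ℚ
inv-inverseˡ {x} x≢0 with x ≟ 0ℚ
... | yes x≡0  = contradiction x≡0 x≢0
... | no  x≢0′ = ℚ.*-inverseˡ x {{≢-nonZero x≢0′}}

*≡1⇒≢0 : ∀ {a x} → a * x ≡ 1ℚ → x ≢ 0ℚ
*≡1⇒≢0 {a} ax≡1 x≡0 = ℚ.1≢0 (trans (sym ax≡1) (trans (cong (a *_) x≡0) (ℚ.*-zeroʳ a)))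

inv-unique : ∀ {a x} → a * x ≡ 1ℚ → inv x ≡ a
inv-unique {a} {x} ax≡1 = begin
  inv x            ≡⟨ ℚ.*-identityʳ (inv x) ⟨
  inv x * 1ℚ       ≡⟨ cong (inv x *_) ax≡1 ⟨
  inv x * (a * x)  ≡⟨ swap (inv x) a x ⟩
  a * (inv x * x)  ≡⟨ cong (a *_) (inv-inverseˡ (*≡1⇒≢0 {a} ax≡1)) ⟩
  a * 1ℚ           ≡⟨ ℚ.*-identityʳ a ⟩
  a                ∎
  where
  swap : ∀ u v w → u * (v * w) ≡ v * (u * w)
  swap = solve-∀ ℚ-ring

inv-* : ∀ {x y} → x ≢ 0ℚ → y ≢ 0ℚ → inv (x * y) ≡ inv x * inv y
inv-* {x} {y} x≢0 y≢0 = inv-unique (begin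
  inv x * inv y * (x * y)  ≡⟨ interchange (inv x) (inv y) x y ⟩
  inv x * x * (inv y * y)  ≡⟨ cong₂ _*_ (inv-inverseˡ x≢0) (inv-inverseˡ y≢0) ⟩
  1ℚ                       ∎)
  where
  interchange : ∀ a b c d → a * b * (c * d) ≡ a * c * (b * d)
  interchange = solve-∀ ℚ-ring

pow-inverseˡ : ∀ {x} → x ≢ 0ℚ → ∀ k → pow (inv x) k * pow x k ≡ 1ℚ
pow-inverseˡ {x} x≢0 k = begin
  pow (inv x) k * pow x k  ≡⟨ pow-distrib-* (inv x) x k ⟨
  pow (inv x * x) k        ≡⟨ cong (λ z → pow z k) (inv-inverseˡ x≢0) ⟩
  pow 1ℚ k                 ≡⟨ pow-1ℚ k ⟩
  1ℚ                       ∎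

1-x≢0 : ∀ {x} → x ≢ 1ℚ → 1ℚ - x ≢ 0ℚ
1-x≢0 {x} x≢1 1-x≡0 = x≢1 (begin
  x              ≡⟨ 1-[1-x]≡x x ⟨
  1ℚ - (1ℚ - x)  ≡⟨ cong (λ y → 1ℚ - y) 1-x≡0 ⟩
  1ℚ             ∎)
  where
  1-[1-x]≡x : ∀ x → 1ℚ - (1ℚ - x) ≡ x
  1-[1-x]≡x = solve-∀ ℚ-ring

square-nonNeg : ∀ s → NonNegative (s * s)
square-nonNeg s with ℚ.≤-total 0ℚ s
... | inj₁ 0≤s = ℚ.nonNeg*nonNeg⇒nonNeg s {{nonNegative 0≤s}} s {{nonNegative 0≤s}}
... | inj₂ s≤0 = ℚ.nonPos*nonPos⇒nonPos s {{nonPositive s≤0}} s {{nonPositive s≤0}}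

pow-nonNeg : ∀ x .{{_ : NonNegative x}} k → NonNegative (pow x k)
pow-nonNeg x zero    = _
pow-nonNeg x (suc k) = ℚ.nonNeg*nonNeg⇒nonNeg x (pow x k) {{pow-nonNeg x k}}

1+nonNeg≢0 : ∀ x .{{_ : NonNegative x}} → 1ℚ + x ≢ 0ℚ
1+nonNeg≢0 x 1+x≡0 = ℚ.<⇒≢ (ℚ.positive⁻¹ (1ℚ + x) {{ℚ.pos+nonNeg⇒pos 1ℚ x}}) (sym 1+x≡0)

linear-recurrence-unique : ∀ (c : ℚ) (a u v : ℕ → ℚ) → u 0 ≡ v 0 →
  (∀ n → u (suc n) ≡ c * u n + a n) → (∀ n → v (suc n) ≡ c * v n + a n) → ∀ n → u n ≡ v n
linear-recurrence-unique c a u v u₀≡v₀ u-rec v-rec zero    = u₀≡v₀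
linear-recurrence-unique c a u v u₀≡v₀ u-rec v-rec (suc n) = begin
  u (suc n)      ≡⟨ u-rec n ⟩
  c * u n + a n  ≡⟨ cong (λ x → c * x + a n) (linear-recurrence-unique c a u v u₀≡v₀ u-rec v-rec n) ⟩
  c * v n + a n  ≡⟨ v-rec n ⟨
  v (suc n)      ∎

qInteger : ℚ → ℕ → ℚ
qInteger q k = (1ℚ - pow q k) * inv (1ℚ - q)

T-summand : ℕ → ℚ → ℕ → ℕ → ℚ
T-summand M s n k = sgn (n ℕ.∸ k) * pow (qInteger (s * s) k) M * pow s (M ℕ.* (n ℕ.∸ k))

T-suc : ∀ M n s → T M (suc n) s ≡ (- pow s M) * T M n s + pow (qInteger (s * s) (suc n)) M
T-suc M n s = begin
  ΣFrom 1 (suc n) (T-summand M s (suc n))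
    ≡⟨ ΣFrom-snoc 1 n (T-summand M s (suc n)) ⟩
  ΣFrom 1 n (T-summand M s (suc n)) + T-summand M s (suc n) (suc n)
    ≡⟨ cong₂ _+_ (ΣFrom-cong 1 n (λ i i<n → earlier i<n)) last ⟩
  ΣFrom 1 n (λ k → (- pow s M) * T-summand M s n k) + X (suc n)
    ≡⟨ cong (_+ X (suc n)) (*-distribˡ-ΣFrom 1 n (- pow s M) (T-summand M s n)) ⟨
  (- pow s M) * ΣFrom 1 n (T-summand M s n) + X (suc n) ∎
  where
  X : ℕ → ℚ
  X k = pow (qInteger (s * s) k) M
  earlier : ∀ {i} → i < n → T-summand M s (suc n) (suc i) ≡ (- pow s M) * T-summand M s n (suc i)
  earlier {i} i<n = begin
    sgn (n ℕ.∸ i) * X (suc i) * pow s (M ℕ.* (n ℕ.∸ i))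
      ≡⟨ cong (λ j → sgn j * X (suc i) * pow s (M ℕ.* j)) (ℕ.+-∸-assoc 1 i<n) ⟩
    sgn (suc j) * X (suc i) * pow s (M ℕ.* suc j)
      ≡⟨ cong (λ k → sgn (suc j) * X (suc i) * pow s k) (ℕ.*-suc M j) ⟩
    sgn (suc j) * X (suc i) * pow s (M ℕ.+ M ℕ.* j)
      ≡⟨ cong (sgn (suc j) * X (suc i) *_) (pow-+ s M (M ℕ.* j)) ⟩
    - 1ℚ * sgn j * X (suc i) * (pow s M * pow s (M ℕ.* j))
      ≡⟨ regroup (sgn j) (X (suc i)) (pow s M) (pow s (M ℕ.* j)) ⟩
    (- pow s M) * (sgn j * X (suc i) * pow s (M ℕ.* j)) ∎
    where
    j : ℕ
    j = n ℕ.∸ suc i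
    regroup : ∀ σ x c z → - 1ℚ * σ * x * (c * z) ≡ (- c) * (σ * x * z)
    regroup = solve-∀ ℚ-ring
  last : T-summand M s (suc n) (suc n) ≡ X (suc n)
  last = begin
    sgn (n ℕ.∸ n) * X (suc n) * pow s (M ℕ.* (n ℕ.∸ n))
      ≡⟨ cong (λ j → sgn j * X (suc n) * pow s (M ℕ.* j)) (ℕ.n∸n≡0 n) ⟩
    1ℚ * X (suc n) * pow s (M ℕ.* 0)
      ≡⟨ cong (λ k → 1ℚ * X (suc n) * pow s k) (ℕ.*-zeroʳ M) ⟩
    1ℚ * X (suc n) * 1ℚ
      ≡⟨ unit (X (suc n)) ⟩
    X (suc n) ∎
    where
    unit : ∀ x → 1ℚ * x * 1ℚ ≡ x
    unit = solve-∀ ℚ-ring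

closedFormNumerator : ℚ → ℕ → ℕ → ℕ → ℚ
closedFormNumerator q a r n = (1ℚ - pow q (n ℕ.* a)) * (1ℚ - pow q (suc n ℕ.* a)) * pow q (r ℕ.* n)

closedFormNumerator-suc : ∀ q a r n → let y = pow q (suc n) in
  closedFormNumerator q a r (suc n) + pow q (r ℕ.+ a) * closedFormNumerator q a r n
  ≡ (1ℚ + pow q a) * (pow y r * (1ℚ - pow y a) * (1ℚ - pow y a))
closedFormNumerator-suc q a r n =
  in-powers (pow-+ q a (n ℕ.* a)) (pow-+ q a (suc n ℕ.* a))
            (trans (cong (pow q) (ℕ.*-suc r n)) (pow-+ q r (r ℕ.* n))) (pow-+ q r a)
            (trans (pow-*-assoc q (suc n) r) (cong (pow q) (ℕ.*-comm (suc n) r)))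
            (pow-*-assoc q (suc n) a)
  where
  P U Q V : ℚ
  P = pow q a
  U = pow q (n ℕ.* a)
  Q = pow q r
  V = pow q (r ℕ.* n)
  identity : ∀ P U Q V →
    (1ℚ - P * U) * (1ℚ - P * (P * U)) * (Q * V) + Q * P * ((1ℚ - U) * (1ℚ - P * U) * V)
    ≡ (1ℚ + P) * (Q * V * (1ℚ - P * U) * (1ℚ - P * U))
  identity = solve-∀ ℚ-ring
  in-powers : ∀ {PU P²U QV QP yʳ yᵃ} →
    PU ≡ P * U → P²U ≡ P * PU → QV ≡ Q * V → QP ≡ Q * P → yʳ ≡ QV → yᵃ ≡ PU →
    (1ℚ - PU) * (1ℚ - P²U) * QV + QP * ((1ℚ - U) * (1ℚ - PU) * V)
    ≡ (1ℚ + P) * (yʳ * (1ℚ - yᵃ) * (1ℚ - yᵃ))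
  in-powers refl refl refl refl refl refl = identity P U Q V

closedFormTerm : ℕ → ℚ → ℕ → ℕ → ℚ
closedFormTerm m q n r = alternatingBinomial (2 ℕ.* m) r * closedFormNumerator q (m ℕ.∸ r) r n
                         * inv (pow (1ℚ - q) (2 ℕ.* m) * (1ℚ + pow q (m ℕ.∸ r)))

closedForm : ℕ → ℚ → ℕ → ℚ
closedForm m q n = ΣFrom 0 m (closedFormTerm m q n)

closedForm-zero : ∀ m q → closedForm m q 0 ≡ 0ℚ
closedForm-zero m q = trans (ΣFrom-cong 0 m (λ r _ → vanishing-factor r)) (ΣFrom-zero 0 m)
  where
  vanish : ∀ c x y z → c * (0ℚ * x * y) * z ≡ 0ℚ
  vanish = solve-∀ ℚ-ring
  vanishing-factor : ∀ r → closedFormTerm m q 0 r ≡ 0ℚ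
  vanishing-factor r = vanish (alternatingBinomial (2 ℕ.* m) r) (1ℚ - pow q (1 ℕ.* (m ℕ.∸ r)))
                              (pow q (r ℕ.* 0)) (inv (pow (1ℚ - q) (2 ℕ.* m) * (1ℚ + pow q (m ℕ.∸ r))))

module _ (q : ℚ) .{{_ : NonNegative q}} (q≢1 : q ≢ 1ℚ) (m : ℕ) where

  private
    W : ℚ
    W = pow (1ℚ - q) (2 ℕ.* m)
    1-q≢0 : 1ℚ - q ≢ 0ℚ
    1-q≢0 = 1-x≢0 q≢1
    inv-W : inv W ≡ pow (inv (1ℚ - q)) (2 ℕ.* m)
    inv-W = inv-unique (pow-inverseˡ 1-q≢0 (2 ℕ.* m))
    W≢0 : W ≢ 0ℚ
    W≢0 = *≡1⇒≢0 {pow (inv (1ℚ - q)) (2 ℕ.* m)} (pow-inverseˡ 1-q≢0 (2 ℕ.* m))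

  closedFormTerm-suc : ∀ n {r} → r ≤ m → let y = pow q (suc n) in
    closedFormTerm m q (suc n) r + pow q m * closedFormTerm m q n r
    ≡ inv W * (alternatingBinomial (2 ℕ.* m) r
               * (pow y r * (1ℚ - pow y (m ℕ.∸ r)) * (1ℚ - pow y (m ℕ.∸ r))))
  closedFormTerm-suc n {r} r≤m = begin
    c * N (suc n) * I + pow q m * (c * N n * I)  ≡⟨ factor c (N (suc n)) (N n) (pow q m) I ⟩
    c * (N (suc n) + pow q m * N n) * I          ≡⟨ cong (λ k → c * (N (suc n) + pow q k * N n) * I)
                                                         (ℕ.m+[n∸m]≡n r≤m) ⟨
    c * (N (suc n) + pow q (r ℕ.+ a) * N n) * I  ≡⟨ cong (λ x → c * x * I) (closedFormNumerator-suc q a r n) ⟩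
    c * ((1ℚ + P) * X) * I                       ≡⟨ cong (c * ((1ℚ + P) * X) *_) (inv-* W≢0 1+P≢0) ⟩
    c * ((1ℚ + P) * X) * (inv W * inv (1ℚ + P))  ≡⟨ regroup c (1ℚ + P) X (inv W) (inv (1ℚ + P)) ⟩
    inv W * (c * X) * (inv (1ℚ + P) * (1ℚ + P))  ≡⟨ cong (inv W * (c * X) *_) (inv-inverseˡ 1+P≢0) ⟩
    inv W * (c * X) * 1ℚ                         ≡⟨ ℚ.*-identityʳ _ ⟩
    inv W * (c * X)                              ∎
    where
    a : ℕ
    a = m ℕ.∸ r
    c P I y X : ℚ
    c = alternatingBinomial (2 ℕ.* m) r
    P = pow q a
    I = inv (W * (1ℚ + P))
    y = pow q (suc n)
    X = pow y r * (1ℚ - pow y a) * (1ℚ - pow y a)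
    N : ℕ → ℚ
    N = closedFormNumerator q a r
    1+P≢0 : 1ℚ + P ≢ 0ℚ
    1+P≢0 = 1+nonNeg≢0 P {{pow-nonNeg q a}}
    factor : ∀ c u v t i → c * u * i + t * (c * v * i) ≡ c * (u + t * v) * i
    factor = solve-∀ ℚ-ring
    regroup : ∀ c p x w j → c * (p * x) * (w * j) ≡ w * (c * x) * (j * p)
    regroup = solve-∀ ℚ-ring

  closedForm-suc : .{{_ : NonZero m}} → ∀ n →
    closedForm m q (suc n) ≡ (- pow q m) * closedForm m q n + pow (qInteger q (suc n)) (2 ℕ.* m)
  closedForm-suc n = isolate {z = closedForm m q n} {c = pow q m} (begin
    closedForm m q (suc n) + pow q m * closedForm m q n
      ≡⟨ cong (closedForm m q (suc n) +_) (*-distribˡ-ΣFrom 0 m (pow q m) (closedFormTerm m q n)) ⟩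
    ΣFrom 0 m (closedFormTerm m q (suc n)) + ΣFrom 0 m (λ r → pow q m * closedFormTerm m q n r)
      ≡⟨ ΣFrom-distrib-+ 0 m (closedFormTerm m q (suc n)) _ ⟨
    ΣFrom 0 m (λ r → closedFormTerm m q (suc n) r + pow q m * closedFormTerm m q n r)
      ≡⟨ ΣFrom-cong 0 m (λ r r<m → closedFormTerm-suc n (ℕ.<⇒≤ r<m)) ⟩
    ΣFrom 0 m (λ r → inv W * S r)
      ≡⟨ *-distribˡ-ΣFrom 0 m (inv W) S ⟨
    inv W * ΣFrom 0 m S
      ≡⟨ cong₂ _*_ inv-W (alternating-binomial-squares m y) ⟩
    pow (inv (1ℚ - q)) (2 ℕ.* m) * pow (1ℚ - y) (2 ℕ.* m)
      ≡⟨ ℚ.*-comm (pow (inv (1ℚ - q)) (2 ℕ.* m)) (pow (1ℚ - y) (2 ℕ.* m)) ⟩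
    pow (1ℚ - y) (2 ℕ.* m) * pow (inv (1ℚ - q)) (2 ℕ.* m)
      ≡⟨ pow-distrib-* (1ℚ - y) (inv (1ℚ - q)) (2 ℕ.* m) ⟨
    pow (qInteger q (suc n)) (2 ℕ.* m) ∎)
    where
    y : ℚ
    y = pow q (suc n)
    S : ℕ → ℚ
    S r = alternatingBinomial (2 ℕ.* m) r * (pow y r * (1ℚ - pow y (m ℕ.∸ r)) * (1ℚ - pow y (m ℕ.∸ r)))
    isolate : ∀ {x z c a} → x + c * z ≡ a → x ≡ (- c) * z + a
    isolate {x} {z} {c} refl = rearrange x z c
      where
      rearrange : ∀ x z c → x ≡ (- c) * z + (x + c * z)
      rearrange = solve-∀ ℚ-ring

lemma2p2 : (m n : ℕ) → 1 ≤ m → 1 ≤ n → (s : ℚ) → s * s ≢ 1ℚ →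
    T (2 ℕ.* m) n s ≡
      Σ[ 0 to m ℕ.∸ 1 ] (λ r →
        sgn r * ℕ→ℚ ((2 ℕ.* m) C r)
          * ((1ℚ - pow (s * s) (n ℕ.* (m ℕ.∸ r)))
             * (1ℚ - pow (s * s) ((ℕ.suc n) ℕ.* (m ℕ.∸ r)))
             * pow (s * s) (r ℕ.* n))
          * inv (pow (1ℚ - s * s) (2 ℕ.* m) * (1ℚ + pow (s * s) (m ℕ.∸ r))))
lemma2p2 m@(suc _) n _ _ s s²≢1 =
  linear-recurrence-unique (- pow s (2 ℕ.* m)) (λ k → pow (qInteger (s * s) (suc k)) (2 ℕ.* m))
    (λ k → T (2 ℕ.* m) k s) (closedForm m (s * s))
    (sym (closedForm-zero m (s * s)))
    (λ k → T-suc (2 ℕ.* m) k s)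
    (λ k → trans (closedForm-suc (s * s) {{square-nonNeg s}} s²≢1 m k)
                 (cong (λ c → (- c) * closedForm m (s * s) k + pow (qInteger (s * s) (suc k)) (2 ℕ.* m))
                       (sym (pow-2*≡pow-square s m))))
    n
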